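{- Let $G$ be a connected graph with neighborhood diversity $k$, and let $T_1,\dots,T_k$ be a partition of $V(G)$ into sets of pairwise twin vertices. Let $S\subseteq V(G)$ and $I_\emptyset=\{i\in[k] : |S\cap T_i|=0\}$. If $i\notin I_\emptyset$ and $T_i$ is not reachable to $T_i$ itself in $S$, then each vertex of $T_i\cap S$ forms by itself a connected component of $G[S]$ (of size $1$).
   Context: Two vertices $u,v$ are twins if $N(u)\setminus\{v\}=N(v)\setminus\{u\}$; each $T_i$ is thus a clique or an independent set. The neighborhood diversity of $G$ is the minimum number of sets in a partition of $V(G)$ into sets of pairwise twin vertices. Two vertex sets are adjacent if some edge joins a vertex of one to a vertex of the other. For $i,i'\notin I_\emptyset$ (not necessarily distinct), $T_i$ and $T_{i'}$ are reachable in $S$ if either $T_i=T_{i'}$ and $T_i$ is a clique, or there is a sequence of indices $i_0,\dots,i_\ell$ with $\ell\ge 1$, $i_0=i$, $i_\ell=i'$, $i_j\notin I_\emptyset$ for all $j$, and $T_{i_j}$ adjacent to $T_{i_{j+1}}$ for $0\le j<\ell$. -}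

module Defs where

open import Level using (0ℓ)
open import Data.Nat using (ℕ; _≤_)
open import Data.Fin using (Fin)
open import Data.Product using (Σ; ∃; _×_; _,_)
open import Data.Sum using (_⊎_)
open import Relation.Nullary using (¬_)
open import Relation.Binary.PropositionalEquality using (_≡_; _≢_)
open import Relation.Binary.Construct.Closure.ReflexiveTransitive using (Star)
open import Function.Bundles using (_⇔_)
open import Function.Definitions using (Surjective)

record Graph (n : ℕ) : Set₁ where
  field
    Adj   : Fin n → Fin n → Set
    sym   : ∀ {u v} → Adj u v → Adj v u
    irrefl : ∀ {u} → ¬ Adj u u
open Graph public

module _ {n : ℕ} (G : Graph n) where

  Connected : Set
  Connected = ∀ u v → Star (Adj G) u v

  Twins : Fin n → Fin n → Set
  Twins u v = ∀ w → w ≢ u → w ≢ v → (Adj G u w ⇔ Adj G v w)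

  -- A partition of V(G) into m (nonempty) parts of pairwise twin vertices,
  -- given by the map sending a vertex to the index of its part.
  IsTwinPartition : (m : ℕ) → (Fin n → Fin m) → Set
  IsTwinPartition m T =
    Surjective _≡_ _≡_ T × (∀ u v → T u ≡ T v → Twins u v)

  NeighborhoodDiversity : ℕ → Set
  NeighborhoodDiversity k =
    (Σ (Fin n → Fin k) (IsTwinPartition k)) ×
    (∀ m (T : Fin n → Fin m) → IsTwinPartition m T → k ≤ m)

  module _ {k : ℕ} (T : Fin n → Fin k) (S : Fin n → Set) where

    NotEmptyIdx : Fin k → Set
    NotEmptyIdx i = ∃ λ v → S v × T v ≡ i

    IsCliquePart : Fin k → Set
    IsCliquePart i = ∀ u v → T u ≡ i → T v ≡ i → u ≢ v → Adj G u v

    PartsAdjacent : Fin k → Fin k → Set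
    PartsAdjacent i j = ∃ λ u → ∃ λ v → T u ≡ i × T v ≡ j × Adj G u v

    Step : Fin k → Fin k → Set
    Step i j = NotEmptyIdx i × NotEmptyIdx j × PartsAdjacent i j

    data Chain : Fin k → Fin k → Set where
      one  : ∀ {i j} → Step i j → Chain i j
      cons : ∀ {i j l} → Step i j → Chain j l → Chain i l

    Reachable : Fin k → Fin k → Set
    Reachable i i' = (i ≡ i' × IsCliquePart i) ⊎ Chain i i'

    AdjIn : Fin n → Fin n → Set
    AdjIn u v = S u × S v × Adj G u v

    -- {v} is a connected component of G[S] (v ∈ S assumed separately):
    -- every vertex reachable from v in G[S] is v itself.
    SingletonComponent : Fin n → Set
    SingletonComponent v = ∀ w → Star AdjIn v w → w ≡ v

-- An S-edge vw with T v ≡ i gives the closed chain i, T w, i: T_i is adjacent to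
-- T_{T w} and back, so T_i would be reachable to itself in S. Hence v has no
-- neighbour in G[S], and {v} is a component.
module Submission where

open import Defs
open import Data.Nat using (ℕ)
open import Data.Fin using (Fin)
open import Data.Product using (_,_)
open import Data.Sum using (inj₂)
open import Data.Empty using (⊥-elim)
open import Relation.Nullary using (¬_)
open import Relation.Binary.PropositionalEquality using (_≡_; refl)
open import Relation.Binary.Construct.Closure.ReflexiveTransitive using (Star; ε; _◅_)

module _ {n k : ℕ} (G : Graph n) (T : Fin n → Fin k) (S : Fin n → Set) where

  AdjIn⇒Step : ∀ {u w} → AdjIn G T S u w → Step G T S (T u) (T w)
  AdjIn⇒Step {u} {w} (su , sw , uw) =
    (u , su , refl) , (w , sw , refl) , (u , w , refl , refl , uw)

  Step-sym : ∀ {i j} → Step G T S i j → Step G T S j i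
  Step-sym (ni , nj , (u , w , tu , tw , uw)) =
    nj , ni , (w , u , tw , tu , Graph.sym G uw)

  AdjIn⇒Reachable-self : ∀ {u w} → AdjIn G T S u w → Reachable G T S (T u) (T u)
  AdjIn⇒Reachable-self e = inj₂ (cons (AdjIn⇒Step e) (one (Step-sym (AdjIn⇒Step e))))

  isolated⇒SingletonComponent : ∀ v → (∀ w → ¬ AdjIn G T S v w) →
                                SingletonComponent G T S v
  isolated⇒SingletonComponent v isolated .v ε        = refl
  isolated⇒SingletonComponent v isolated w  (e ◅ _) = ⊥-elim (isolated _ e)

lemma4 : ∀ {n k : ℕ} (G : Graph n) → Connected G → NeighborhoodDiversity G k →
    (T : Fin n → Fin k) → IsTwinPartition G k T →
    (S : Fin n → Set) → (i : Fin k) →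
    NotEmptyIdx G T S i → ¬ Reachable G T S i i →
    ∀ v → S v → T v ≡ i → SingletonComponent G T S v
lemma4 G _ _ T _ S i _ unreachable v _ refl =
  isolated⇒SingletonComponent G T S v
    (λ w e → unreachable (AdjIn⇒Reachable-self G T S e))
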